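{- If $v$ and $h$ are positive integers such that (i) $\nu_p(h)\ge\lceil\nu_p(v)/2\rceil$ for every prime divisor $p$ of $v$, and (ii) $\nu_2(h)\ge 2$ if $v\equiv 2\pmod 4$, then a (circulant) $\mathrm{BH}(\mathbb{Z}_v,h)$ matrix exists.
   Context: $\nu_p(t)$ is the $p$-adic valuation of $t$. $\mathbb{Z}_v$ is the cyclic group of order $v$. A $\mathrm{BH}(\mathbb{Z}_v,h)$ matrix is a $v\times v$ matrix $H=(H_{g,k})_{g,k\in\mathbb{Z}_v}$ with entries complex $h$th roots of unity, $\mathbb{Z}_v$-invariant ($H_{g+l,k+l}=H_{g,k}$ for all $g,k,l$), with $HH^*=vI$, where $H^*$ is the conjugate transpose. -}

module Defs where

open import Data.Nat.Base using (ℕ; zero; suc; NonZero; _≤_; _<_; ⌈_/2⌉; _∸_; _%_; _+_)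
  renaming (_^_ to _^ℕ_)
open import Data.Nat.Divisibility using (_∣_)
open import Data.Nat.Primality using (Prime)
open import Data.Nat.DivMod using (_mod_)
open import Data.Fin.Base using (Fin; toℕ)
open import Data.Product using (_×_; Σ; ∃)
open import Data.Sum using (_⊎_)
open import Relation.Nullary using (¬_)
open import Relation.Binary.PropositionalEquality using (_≡_)
import Level as L
open import Algebra.Bundles using (CommutativeRing; Semiring)

-- p-adic valuation, as a relation:  IsValuation p n k  means  ν_p(n) = k
-- (p^k ∣ n and p^(k+1) ∤ n); used only for positive n.

IsValuation : ℕ → ℕ → ℕ → Set
IsValuation p n k = (p ^ℕ k ∣ n) × ¬ (p ^ℕ suc k ∣ n)

CondI : ℕ → ℕ → Set
CondI v h = ∀ p → Prime p → p ∣ v →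
            ∀ a b → IsValuation p v a → IsValuation p h b → ⌈ a /2⌉ ≤ b

CondII : ℕ → ℕ → Set
CondII v h = v % 4 ≡ 2 → ∀ b → IsValuation 2 h b → 2 ≤ b

-- The cyclic group ℤ_v, realised on Fin v with addition mod v.

_⊕[_]_ : ∀ {v} → Fin v → (w : ℕ) → .{{_ : NonZero w}} → Fin v → Fin w
g ⊕[ w ] l = (toℕ g + toℕ l) mod w

-- Ring-theoretic notions.  The complex numbers are replaced by an
-- arbitrary integral domain of characteristic 0 containing a primitive
-- h-th root of unity ζ.

module _ {c ℓ} (R : CommutativeRing c ℓ) where
  open CommutativeRing R
  open import Algebra.Definitions.RawSemiring (Semiring.rawSemiring semiring) using (_^_; sum)
    renaming (_×_ to _·_)

  IsIntegralDomain : Set (c L.⊔ ℓ)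
  IsIntegralDomain = (¬ (1# ≈ 0#)) × (∀ x y → x * y ≈ 0# → (x ≈ 0#) ⊎ (y ≈ 0#))

  CharZero : Set ℓ
  CharZero = ∀ n → n · 1# ≈ 0# → n ≡ 0

  IsPrimitiveRoot : ℕ → Carrier → Set ℓ
  IsPrimitiveRoot h ζ = (ζ ^ h ≈ 1#) × (∀ m → 1 ≤ m → m < h → ¬ (ζ ^ m ≈ 1#))

  -- A BH(ℤ_v, h) matrix, given by its exponent matrix E : entry (g,k) is
  -- ζ ^ E g k (every h-th root of unity is such a power, ζ primitive);
  -- its complex conjugate is ζ ^ (h ∸ E g k).
  module _ (v h : ℕ) .{{_ : NonZero v}} (ζ : Carrier) where

    entry : (Fin v → Fin v → Fin h) → Fin v → Fin v → Carrier
    entry E g k = ζ ^ toℕ (E g k)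

    conjEntry : (Fin v → Fin v → Fin h) → Fin v → Fin v → Carrier
    conjEntry E g k = ζ ^ (h ∸ toℕ (E g k))

    IsInvariant : (Fin v → Fin v → Fin h) → Set
    IsInvariant E = ∀ g k l → E (g ⊕[ v ] l) (k ⊕[ v ] l) ≡ E g k

    IsOrthogonal : (Fin v → Fin v → Fin h) → Set ℓ
    IsOrthogonal E = ∀ g g' →
      (g ≡ g' → sum (λ k → entry E g k * conjEntry E g' k) ≈ v · 1#) ×
      (¬ (g ≡ g') → sum (λ k → entry E g k * conjEntry E g' k) ≈ 0#)

    IsBH : (Fin v → Fin v → Fin h) → Set ℓ
    IsBH E = IsInvariant E × IsOrthogonal E

module Submission where

open import Defs
open import Data.Nat.Base using (ℕ; NonZero)
open import Data.Fin.Base using (Fin)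
open import Data.Product using (∃)
open import Algebra.Bundles using (CommutativeRing)

-- Write v = k·m and h = w·m with k ∣ m, and let ζ be a primitive h-th root of
-- unity, ω = ζ^w (a primitive m-th root) and ρ = ζ^B with ρ² = ω^k and
-- ρ^(m²) = 1.  The Gauss-type sequence g(a + b·k) = ω^(a·b) ρ^(b²) (a < k) is
-- v-periodic and satisfies g(x + t·k) = g(x)·ω^(t·x)·ρ^(t²).  Its cyclic
-- correlations vanish: shifting the summation index by k shows that the
-- correlation of the shifts by c and c′ is 0 unless c ≡ c′ (mod m); in that
-- case c′ ≡ c + t·k (mod v) with 0 < t < m, and shifting the index by 1
-- multiplies every term by ω^t ≠ 1.  So the circulant matrix with entries
-- g(j − g) is a BH(ℤ_v, h) matrix.
--
-- The module Arithmetic derives the data (k, m, w, B), a `Shape`, from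
-- conditions (i) and (ii): (i) gives v ∣ h², so m = gcd(v, h) works, up to a
-- rescaling by 2 that (ii) permits.

module Arithmetic where
  open import Data.Nat.Base
  open import Data.Nat.Properties
  open import Data.Nat.Divisibility
  open import Data.Nat.Primality using (Prime; euclidsLemma; prime[2]; prime⇒nonZero; prime⇒nonTrivial)
  open import Data.Nat.Primality.Factorisation using (factorise)
  open import Data.Nat.ListAction using (product)
  open import Data.Nat.GCD using (gcd; gcd[m,n]∣m; gcd[m,n]∣n; gcd[m,n]≢0; m/gcd[m,n]≢0; gcd-greatest)
  open import Data.Nat.Coprimality using (coprime-/gcd; coprime-divisor)
  open import Data.Nat.DivMod using (m/n*n≡m; [m+kn]%n≡m%n; m≡m%n+[m/n]*n; m<n⇒m%n≡m; %-distribˡ-+; %-distribˡ-*; m%n%n≡m%n)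
  open import Data.Nat.Induction using (<-rec)
  open import Data.Nat.Tactic.RingSolver using (solve-∀)
  open import Data.List.Base using ([]; _∷_)
  open import Data.List.Relation.Unary.All using (_∷_)
  open import Data.Product using (_×_; _,_; proj₁; proj₂; ∃; ∃-syntax)
  open import Data.Sum using (_⊎_; inj₁; inj₂)
  open import Relation.Binary.Definitions using (tri<; tri≈; tri>)
  open import Relation.Nullary using (¬_; Dec; yes; no; contradiction)
  open import Relation.Binary.PropositionalEquality
  open import Function.Base using (_∘′_)

  prime-divisor : ∀ n → 1 < n → ∃[ p ] Prime p × p ∣ n
  prime-divisor n@(suc _) 1<n with factorise n
  ... | record { factors = [] ; isFactorisation = n≡1 } = contradiction n≡1 (>⇒≢ 1<n)
  ... | record { factors = p ∷ ps ; isFactorisation = n≡pps ; factorsPrime = p-prime ∷ _ } =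
    p , p-prime , subst (p ∣_) (sym n≡pps) (m∣m*n (product ps))

  valuation-*p : ∀ {p q a} .{{_ : NonZero p}} → IsValuation p q a → IsValuation p (q * p) (suc a)
  valuation-*p {p} {q} {a} (pᵃ∣q , pᵃ⁺¹∤q) =
    subst (p ^ suc a ∣_) (*-comm p q) (*-monoʳ-∣ p pᵃ∣q) ,
    λ pᵃ⁺²∣qp → pᵃ⁺¹∤q (*-cancelˡ-∣ p (subst (p ^ suc (suc a) ∣_) (*-comm q p) pᵃ⁺²∣qp))

  valuation : ∀ {p} → 1 < p → ∀ n → 0 < n → ∃ (IsValuation p n)
  valuation {p} 1<p = <-rec _ step
    where
    instance
      p≢0 : NonZero p
      p≢0 = >-nonZero (<-trans z<s 1<p)
    step : ∀ n → (∀ {q} → q < n → 0 < q → ∃ (IsValuation p q)) → 0 < n → ∃ (IsValuation p n)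
    step n rec 0<n with p ∣? n
    ... | no p∤n = 0 , 1∣ n , λ p*1∣n → p∤n (subst (_∣ n) (*-identityʳ p) p*1∣n)
    step .(q * p) rec 0<qp | yes (divides-refl q) =
      let a , νq = rec (m<m*n q p {{q≢0}} 1<p) (>-nonZero⁻¹ q {{q≢0}}) in suc a , valuation-*p {a = a} νq
      where q≢0 = m*n≢0⇒m≢0 q {{>-nonZero 0<qp}}

  valuation-bound : ∀ {v h} → CondI v h → ∀ {p a b} → Prime p → p ∣ v →
                    IsValuation p v a → IsValuation p h b → a ≤ b + b
  valuation-bound condI {p} {a} {b} p-prime p∣v νv νh = begin
    a                     ≡⟨ sym (⌊n/2⌋+⌈n/2⌉≡n a) ⟩
    ⌊ a /2⌋ + ⌈ a /2⌉     ≤⟨ +-monoˡ-≤ ⌈ a /2⌉ (⌊n/2⌋≤⌈n/2⌉ a) ⟩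
    ⌈ a /2⌉ + ⌈ a /2⌉     ≤⟨ +-mono-≤ ⌈a/2⌉≤b ⌈a/2⌉≤b ⟩
    b + b                 ∎
    where
    open ≤-Reasoning
    ⌈a/2⌉≤b = condI p p-prime p∣v a b νv νh

  ^-monoʳ-∣ : ∀ p {a c} → a ≤ c → p ^ a ∣ p ^ c
  ^-monoʳ-∣ p {a} {c} a≤c = subst (p ^ a ∣_) pᵃpᶜ⁻ᵃ≡pᶜ (m∣m*n (p ^ (c ∸ a)))
    where
    pᵃpᶜ⁻ᵃ≡pᶜ : p ^ a * p ^ (c ∸ a) ≡ p ^ c
    pᵃpᶜ⁻ᵃ≡pᶜ = trans (sym (^-distribˡ-+-* p a (c ∸ a))) (cong (p ^_) (m+[n∸m]≡n a≤c))

  -- Write v = g·c with g = gcd(v, h²); a prime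
  -- p ∣ c would satisfy p^ν_p(v) ∣ g (as p^ν_p(v) ∣ h² by (i)), whence
  -- p^(ν_p(v)+1) ∣ g·c = v, which is absurd.  Hence c = 1.
  square-divisible : ∀ v h → .{{_ : NonZero v}} → .{{_ : NonZero h}} → CondI v h → v ∣ h * h
  square-divisible v h condI with gcd[m,n]∣m v (h * h)
  ... | divides c v≡cg = by-cofactor c v≡cg
    where
    g = gcd v (h * h)
    by-cofactor : ∀ c → v ≡ c * g → v ∣ h * h
    by-cofactor 0 v≡0 = contradiction v≡0 (≢-nonZero⁻¹ v)
    by-cofactor 1 v≡g = subst (_∣ h * h) (sym (trans v≡g (*-identityˡ g))) (gcd[m,n]∣n v (h * h))
    by-cofactor c@(suc (suc _)) v≡cg with prime-divisor c (s<s (s<s z≤n))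
    ... | p , p-prime , p∣c = contradiction pᵃ⁺¹∣v pᵃ⁺¹∤v
      where
      instance
        p≢0 : NonZero p
        p≢0 = prime⇒nonZero p-prime
      1<p : 1 < p
      1<p = nonTrivial⇒n>1 p {{prime⇒nonTrivial p-prime}}
      p∣v : p ∣ v
      p∣v = subst (p ∣_) (sym v≡cg) (∣m⇒∣m*n g p∣c)
      νv = valuation 1<p v (>-nonZero⁻¹ v)
      νh = valuation 1<p h (>-nonZero⁻¹ h)
      a = proj₁ νv
      b = proj₁ νh
      pᵃ∣h² : p ^ a ∣ h * h
      pᵃ∣h² = ∣-trans (^-monoʳ-∣ p {a} {b + b} (valuation-bound condI {p} {a} {b} p-prime p∣v (proj₂ νv) (proj₂ νh)))
                      (subst (_∣ h * h) (sym (^-distribˡ-+-* p b b))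
                             (*-pres-∣ (proj₁ (proj₂ νh)) (proj₁ (proj₂ νh))))
      pᵃ∣g : p ^ a ∣ g
      pᵃ∣g = gcd-greatest (proj₁ (proj₂ νv)) pᵃ∣h²
      pᵃ⁺¹∣v : p ^ suc a ∣ v
      pᵃ⁺¹∣v = subst₂ _∣_ (*-comm (p ^ a) p) (trans (*-comm g c) (sym v≡cg)) (*-pres-∣ pᵃ∣g p∣c)
      pᵃ⁺¹∤v = proj₂ (proj₂ νv)

  even-or-odd : ∀ n → 2 ∣ n ⊎ 2 ∣ suc n
  even-or-odd zero    = inj₁ (divides 0 refl)
  even-or-odd (suc n) with even-or-odd n
  ... | inj₁ (divides q n≡2q) = inj₂ (divides (suc q) (cong (suc ∘′ suc) n≡2q))
  ... | inj₂ 2∣1+n            = inj₁ 2∣1+n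

  odd-* : ∀ {a b} → ¬ 2 ∣ a → ¬ 2 ∣ b → ¬ 2 ∣ a * b
  odd-* {a} {b} 2∤a 2∤b 2∣ab with euclidsLemma a b prime[2] 2∣ab
  ... | inj₁ 2∣a = 2∤a 2∣a
  ... | inj₂ 2∣b = 2∤b 2∣b

  odd-divisor : ∀ {k n} → ¬ 2 ∣ k → k ∣ 2 * n → k ∣ n
  odd-divisor {k} {n} 2∤k (divides c 2n≡ck) with euclidsLemma c k prime[2] (divides n (trans (sym 2n≡ck) (*-comm 2 n)))
  ... | inj₂ 2∣k = contradiction 2∣k 2∤k
  ... | inj₁ (divides c′ refl) = divides c′ (*-cancelˡ-≡ n (c′ * k) 2 (trans 2n≡ck (solve-∀′ c′ k)))
    where
    solve-∀′ : ∀ c′ k → c′ * 2 * k ≡ 2 * (c′ * k)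
    solve-∀′ = solve-∀

  twice-odd-mod4 : ∀ {n} → ¬ 2 ∣ n → (2 * n) % 4 ≡ 2
  twice-odd-mod4 {zero}  2∤0 = contradiction (divides 0 refl) 2∤0
  twice-odd-mod4 {suc n} 2∤n with even-or-odd n
  ... | inj₂ 2∣1+n = contradiction 2∣1+n 2∤n
  ... | inj₁ (divides s refl) = trans (cong (_% 4) (2[1+2s]≡2+4s s)) ([m+kn]%n≡m%n 2 s 4)
    where
    2[1+2s]≡2+4s : ∀ s → 2 * (1 + s * 2) ≡ 2 + s * 4
    2[1+2s]≡2+4s = solve-∀

  twice-odd-valuation : ∀ {n} → ¬ 2 ∣ n → IsValuation 2 (2 * n) 1
  twice-odd-valuation {n} 2∤n = divides n (*-comm 2 n) , λ 4∣2n → 2∤n (*-cancelˡ-∣ 2 4∣2n)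

  -- For a primitive
  -- h-th root ζ, ω = ζ^w is a primitive m-th root and ρ = ζ^B satisfies
  -- ρ² = ω^k and ρ^(m²) = 1.
  record Shape (v h : ℕ) : Set where
    field
      k m w B X : ℕ
      {{k≢0}}  : NonZero k
      {{m≢0}}  : NonZero m
      v≡km     : v ≡ k * m
      h≡wm     : h ≡ w * m
      k∣m      : k ∣ m
      2B≡kw+Xh : 2 * B ≡ k * w + X * h
      h∣Bm²    : h ∣ B * (m * m)

  -- When k·w·(1+m) is even, B = k·w·(1+m)/2 works (with X = k), because
  -- 2·B·m² = h·k·m·(1+m) and m·(1+m) is even.
  shape-of-even : ∀ {v h} k m w → {{_ : NonZero k}} → {{_ : NonZero m}} →
                  v ≡ k * m → h ≡ w * m → k ∣ m → 2 ∣ k * w * (1 + m) → Shape v h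
  shape-of-even {v} {h} k m w v≡km h≡wm k∣m (divides B kw[1+m]≡B2) = record
    { k = k ; m = m ; w = w ; B = B ; X = k
    ; v≡km = v≡km ; h≡wm = h≡wm ; k∣m = k∣m
    ; 2B≡kw+Xh = 2B≡kw+kh
    ; h∣Bm² = divides (k * T) (*-cancelʳ-≡ (B * (m * m)) (k * T * h) 2 Bm²2≡kTh2) }
    where
    open ≡-Reasoning
    m[1+m]-even : 2 ∣ m * (1 + m)
    m[1+m]-even with even-or-odd m
    ... | inj₁ 2∣m   = ∣m⇒∣m*n (1 + m) 2∣m
    ... | inj₂ 2∣1+m = ∣n⇒∣m*n m 2∣1+m
    T = quotient m[1+m]-even
    2B≡kw+kh : 2 * B ≡ k * w + k * h
    2B≡kw+kh = begin
      2 * B             ≡⟨ *-comm 2 B ⟩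
      B * 2             ≡⟨ sym kw[1+m]≡B2 ⟩
      k * w * (1 + m)   ≡⟨ expand k w m ⟩
      k * w + k * (w * m) ≡⟨ cong (λ x → k * w + k * x) (sym h≡wm) ⟩
      k * w + k * h     ∎
      where
      expand : ∀ k w m → k * w * (1 + m) ≡ k * w + k * (w * m)
      expand = solve-∀
    Bm²2≡kTh2 : B * (m * m) * 2 ≡ k * T * h * 2
    Bm²2≡kTh2 = begin
      B * (m * m) * 2          ≡⟨ regroup₁ B m ⟩
      B * 2 * m * m            ≡⟨ cong (λ x → x * m * m) (sym kw[1+m]≡B2) ⟩
      k * w * (1 + m) * m * m  ≡⟨ regroup₂ k w m ⟩
      k * (w * m) * (m * (1 + m)) ≡⟨ cong₂ (λ x y → k * x * y) (sym h≡wm) (m∣n⇒n≡quotient*m m[1+m]-even) ⟩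
      k * h * (T * 2)          ≡⟨ regroup₃ k h T ⟩
      k * T * h * 2            ∎
      where
      regroup₁ : ∀ B m → B * (m * m) * 2 ≡ B * 2 * m * m
      regroup₁ = solve-∀
      regroup₂ : ∀ k w m → k * w * (1 + m) * m * m ≡ k * (w * m) * (m * (1 + m))
      regroup₂ = solve-∀
      regroup₃ : ∀ k h T → k * h * (T * 2) ≡ k * T * h * 2
      regroup₃ = solve-∀

  -- Under (ii), if v = k·m and h = w·m with k, w odd and m = 2·m₁, then m₁ is
  -- even: otherwise v ≡ 2 (mod 4) while ν₂(h) = 1.
  condII-quarter : ∀ {v h} k m₁ w → CondII v h → ¬ 2 ∣ k → ¬ 2 ∣ w →
                   v ≡ k * (m₁ * 2) → h ≡ w * (m₁ * 2) → 2 ∣ m₁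
  condII-quarter k m₁ w condII 2∤k 2∤w v≡km h≡wm with 2 ∣? m₁
  ... | yes 2∣m₁ = 2∣m₁
  ... | no  2∤m₁ = contradiction
    (condII (subst (λ x → x % 4 ≡ 2) (sym (twice k v≡km)) (twice-odd-mod4 (odd-* 2∤k 2∤m₁)))
            1 (subst (λ x → IsValuation 2 x 1) (sym (twice w h≡wm)) (twice-odd-valuation (odd-* 2∤w 2∤m₁))))
    (λ { (s≤s ()) })
    where
    twice : ∀ {x} x′ → x ≡ x′ * (m₁ * 2) → x ≡ 2 * (x′ * m₁)
    twice x′ x≡x′m₁2 = trans x≡x′m₁2 (regroup x′ m₁)
      where
      regroup : ∀ x′ m₁ → x′ * (m₁ * 2) ≡ 2 * (x′ * m₁)
      regroup = solve-∀

  odd-factors : ∀ a b c → ¬ 2 ∣ a * b * c → ¬ 2 ∣ a × ¬ 2 ∣ b × ¬ 2 ∣ c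
  odd-factors a b c odd = (λ 2∣a → odd (∣m⇒∣m*n c (∣m⇒∣m*n b 2∣a))) ,
                          (λ 2∣b → odd (∣m⇒∣m*n c (∣n⇒∣m*n a 2∣b))) ,
                          (λ 2∣c → odd (∣n⇒∣m*n (a * b) 2∣c))

  -- If k·w·(1+m) is odd, then k, w are odd and m is even, so by (ii) m = 4·m₂;
  -- the odd k divides m₂, and the triple (2k, 2m₂, 2w) has an even product.
  shape-of-odd : ∀ {v h} k m w → {{_ : NonZero k}} → {{_ : NonZero m}} → CondII v h →
                 v ≡ k * m → h ≡ w * m → k ∣ m → ¬ 2 ∣ k * w * (1 + m) → Shape v h
  shape-of-odd k m w condII v≡km h≡wm k∣m odd with odd-factors k w (1 + m) odd | even-or-odd m
  ... | _ , _ , 2∤1+m | inj₂ 2∣1+m = contradiction 2∣1+m 2∤1+m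
  ... | 2∤k , 2∤w , _ | inj₁ (divides m₁ refl) with condII-quarter k m₁ w condII 2∤k 2∤w v≡km h≡wm
  ...   | divides m₂ refl =
    shape-of-even (2 * k) (2 * m₂) (2 * w) {{m*n≢0 2 k}} {{m*n≢0 2 m₂}}
      (trans v≡km (regroup k m₂)) (trans h≡wm (regroup w m₂)) (*-monoʳ-∣ 2 k∣m₂)
      (∣m⇒∣m*n (1 + 2 * m₂) (∣m⇒∣m*n (2 * w) (m∣m*n k)))
    where
    regroup : ∀ x m₂ → x * (m₂ * 2 * 2) ≡ 2 * x * (2 * m₂)
    regroup = solve-∀
    instance
      m₂≢0 : NonZero m₂
      m₂≢0 = m*n≢0⇒m≢0 m₂ {2} {{m*n≢0⇒m≢0 (m₂ * 2) {2}}}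
    k∣m₂ : k ∣ m₂
    k∣m₂ = odd-divisor 2∤k (odd-divisor 2∤k (subst (k ∣_) (four-m₂ m₂) k∣m))
      where
      four-m₂ : ∀ m₂ → m₂ * 2 * 2 ≡ 2 * (2 * m₂)
      four-m₂ = solve-∀

  -- Take m = gcd(v,h), v = k·m and
  -- h = w·m with k, w coprime; v ∣ h² gives k ∣ w²·m, hence k ∣ m.  Then
  -- choose B according to the parity of k·w·(1+m).
  shape : ∀ v h → .{{_ : NonZero v}} → .{{_ : NonZero h}} → CondI v h → CondII v h → Shape v h
  shape v h condI condII = by-parity (2 ∣? k * w * (1 + m))
    where
    m = gcd v h
    k = v / m
    w = h / m
    instance
      m≢0 : NonZero m
      m≢0 = ≢-nonZero (gcd[m,n]≢0 v h (inj₁ (≢-nonZero⁻¹ v)))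
      k≢0 : NonZero k
      k≢0 = ≢-nonZero (m/gcd[m,n]≢0 v h)
    v≡km : v ≡ k * m
    v≡km = sym (m/n*n≡m (gcd[m,n]∣m v h))
    h≡wm : h ≡ w * m
    h≡wm = sym (m/n*n≡m (gcd[m,n]∣n v h))
    k∣m : k ∣ m
    k∣m = coprime-divisor (coprime-/gcd v h) (coprime-divisor (coprime-/gcd v h) k∣w[wm])
      where
      regroup : ∀ w m → w * m * (w * m) ≡ w * (w * m) * m
      regroup = solve-∀
      k∣w[wm] : k ∣ w * (w * m)
      k∣w[wm] = *-cancelʳ-∣ m (subst₂ _∣_ v≡km (trans (cong₂ _*_ h≡wm h≡wm) (regroup w m))
                                      (square-divisible v h condI))
    by-parity : Dec (2 ∣ k * w * (1 + m)) → Shape v h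
    by-parity (yes even) = shape-of-even k m w v≡km h≡wm k∣m even
    by-parity (no  odd)  = shape-of-odd k m w condII v≡km h≡wm k∣m odd

  ordered-gap : ∀ k m .{{_ : NonZero m}} → k ∣ m → ∀ {a a′} → a < a′ → a′ < k * m → a % m ≡ a′ % m →
                ∃[ t ] (1 ≤ t × t < m) × a′ ≡ a + t * k
  ordered-gap k m (divides q m≡qk) {a} {a′} a<a′ a′<km a≡a′ = d * q , (1≤dq , dq<m) , a′≡a+dqk
    where
    open ≡-Reasoning
    Q = a / m
    Q′ = a′ / m
    d = Q′ ∸ Q
    a′∸a≡dm : a′ ∸ a ≡ d * m
    a′∸a≡dm = begin
      a′ ∸ a                            ≡⟨ cong₂ _∸_ (trans (m≡m%n+[m/n]*n a′ m) (cong (_+ Q′ * m) (sym a≡a′)))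
                                                     (m≡m%n+[m/n]*n a m) ⟩
      (a % m + Q′ * m) ∸ (a % m + Q * m) ≡⟨ [m+n]∸[m+o]≡n∸o (a % m) (Q′ * m) (Q * m) ⟩
      Q′ * m ∸ Q * m                    ≡⟨ sym (*-distribʳ-∸ m Q′ Q) ⟩
      d * m                             ∎
    a′≡a+dm : a′ ≡ a + d * m
    a′≡a+dm = trans (sym (m+[n∸m]≡n (<⇒≤ a<a′))) (cong (a +_) a′∸a≡dm)
    a′≡a+dqk : a′ ≡ a + d * q * k
    a′≡a+dqk = trans a′≡a+dm (cong (a +_) (trans (cong (d *_) m≡qk) (sym (*-assoc d q k))))
    1≤d : 1 ≤ d
    1≤d with d | a′≡a+dm
    ... | zero  | a′≡a+0 = contradiction (trans a′≡a+0 (+-identityʳ a)) (>⇒≢ a<a′)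
    ... | suc _ | _      = s≤s z≤n
    d<k : d < k
    d<k = *-cancelʳ-< m d k (≤-<-trans (subst (d * m ≤_) (sym a′≡a+dm) (m≤n+m (d * m) a)) a′<km)
    1≤q : 1 ≤ q
    1≤q = >-nonZero⁻¹ q {{m*n≢0⇒m≢0 q {{subst NonZero m≡qk (≢-nonZero (≢-nonZero⁻¹ m))}}}}
    1≤dq : 1 ≤ d * q
    1≤dq = *-mono-≤ 1≤d 1≤q
    dq<m : d * q < m
    dq<m = subst (d * q <_) (trans (*-comm k q) (sym m≡qk)) (*-monoˡ-< q {{>-nonZero 1≤q}} d<k)

  -- Distinct residues a, a′ < k·m that agree modulo m satisfy a + t·k ≡ a′
  -- (mod k·m) for some 0 < t < m: take the gap t if a < a′, else m − t.
  residue-gap : ∀ k m .{{_ : NonZero m}} .{{_ : NonZero (k * m)}} → k ∣ m →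
                ∀ {a a′} → a < k * m → a′ < k * m → a ≢ a′ → a % m ≡ a′ % m →
                ∃[ t ] (1 ≤ t × t < m) × (a + t * k) % (k * m) ≡ a′
  residue-gap k m k∣m {a} {a′} a<km a′<km a≢a′ a≡a′[m] with <-cmp a a′
  ... | tri< a<a′ _ _ with ordered-gap k m k∣m a<a′ a′<km a≡a′[m]
  ...   | t , t-range , a′≡a+tk = t , t-range , trans (cong (_% (k * m)) (sym a′≡a+tk)) (m<n⇒m%n≡m a′<km)
  residue-gap k m k∣m {a} {a′} a<km a′<km a≢a′ a≡a′[m] | tri≈ _ a≡a′ _ = contradiction a≡a′ a≢a′
  residue-gap k m k∣m {a} {a′} a<km a′<km a≢a′ a≡a′[m] | tri> _ _ a′<a with ordered-gap k m k∣m a′<a a<km (sym a≡a′[m])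
  ...   | t , (1≤t , t<m) , a≡a′+tk =
    m ∸ t , (m<n⇒0<n∸m t<m , ∸-monoʳ-< 1≤t (<⇒≤ t<m)) ,
    trans (cong (_% (k * m)) wraps) (trans ([m+kn]%n≡m%n a′ 1 (k * m)) (m<n⇒m%n≡m a′<km))
    where
    open ≡-Reasoning
    wraps : a + (m ∸ t) * k ≡ a′ + 1 * (k * m)
    wraps = begin
      a + (m ∸ t) * k               ≡⟨ cong (_+ (m ∸ t) * k) a≡a′+tk ⟩
      a′ + t * k + (m ∸ t) * k      ≡⟨ +-assoc a′ (t * k) ((m ∸ t) * k) ⟩
      a′ + (t * k + (m ∸ t) * k)    ≡⟨ cong (a′ +_) (sym (*-distribʳ-+ k t (m ∸ t))) ⟩
      a′ + (t + (m ∸ t)) * k        ≡⟨ cong (λ x → a′ + x * k) (m+[n∸m]≡n (<⇒≤ t<m)) ⟩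
      a′ + m * k                    ≡⟨ cong (a′ +_) (solve-m*k m k) ⟩
      a′ + 1 * (k * m)              ∎
      where
      solve-m*k : ∀ m k → m * k ≡ 1 * (k * m)
      solve-m*k = solve-∀

  +-cong-mod : ∀ d .{{_ : NonZero d}} z {x y} → x % d ≡ y % d → (z + x) % d ≡ (z + y) % d
  +-cong-mod d z {x} {y} x≡y =
    trans (%-distribˡ-+ z x d) (trans (cong (λ w → (z % d + w) % d) x≡y) (sym (%-distribˡ-+ z y d)))

  %-absorbˡ : ∀ d .{{_ : NonZero d}} x y → (x % d + y) % d ≡ (x + y) % d
  %-absorbˡ d x y =
    trans (%-distribˡ-+ (x % d) y d) (trans (cong (λ w → (w + y % d) % d) (m%n%n≡m%n x d)) (sym (%-distribˡ-+ x y d)))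

  *-mod : ∀ d .{{_ : NonZero d}} n y → (n * (y % d)) % d ≡ (n * y) % d
  *-mod d n y =
    trans (%-distribˡ-* n (y % d) d) (trans (cong (λ w → (n % d * w) % d) (m%n%n≡m%n y d)) (sym (%-distribˡ-* n y d)))

  -- Over ℕ the difference j − g (mod v) is represented by j + (v − 1)·g.
  -- It is invariant under a common shift of j and g ...
  difference-shift : ∀ v .{{_ : NonZero v}} j g l →
                     ((j + l) % v + pred v * ((g + l) % v)) % v ≡ (j + pred v * g) % v
  difference-shift v@(suc V) j g l = begin
    ((j + l) % v + V * ((g + l) % v)) % v  ≡⟨ %-absorbˡ v (j + l) (V * ((g + l) % v)) ⟩
    (j + l + V * ((g + l) % v)) % v        ≡⟨ +-cong-mod v (j + l) (*-mod v V (g + l)) ⟩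
    (j + l + V * (g + l)) % v              ≡⟨ cong (_% v) (regroup j l V g) ⟩
    (j + V * g + l * v) % v                ≡⟨ [m+kn]%n≡m%n (j + V * g) l v ⟩
    (j + V * g) % v                        ∎
    where
    open ≡-Reasoning
    regroup : ∀ j l V g → j + l + V * (g + l) ≡ j + V * g + l * suc V
    regroup = solve-∀

  -- ... and (v − 1)·g determines g < v, since g + g′ + (v − 1)·g ≡ g′ (mod v).
  difference-injective : ∀ v .{{_ : NonZero v}} {g g′} → g < v → g′ < v →
                         (pred v * g) % v ≡ (pred v * g′) % v → g ≡ g′
  difference-injective v@(suc V) {g} {g′} g<v g′<v Vg≡Vg′ = begin
    g                          ≡⟨ sym (recover g′ g g<v) ⟩
    (g′ + g + V * g′) % v      ≡⟨ cong (λ x → (x + V * g′) % v) (+-comm g′ g) ⟩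
    (g + g′ + V * g′) % v      ≡⟨ +-cong-mod v (g + g′) (sym Vg≡Vg′) ⟩
    (g + g′ + V * g) % v       ≡⟨ recover g g′ g′<v ⟩
    g′                         ∎
    where
    open ≡-Reasoning
    regroup : ∀ a b V → a + b + V * a ≡ b + a * suc V
    regroup = solve-∀
    recover : ∀ a b → b < v → (a + b + V * a) % v ≡ b
    recover a b b<v = trans (cong (_% v) (regroup a b V)) (trans ([m+kn]%n≡m%n b a v) (m<n⇒m%n≡m b<v))

module IntegralDomainFacts {c ℓ} (R : CommutativeRing c ℓ) (dom : IsIntegralDomain R) where
  open Arithmetic using (residue-gap; +-cong-mod; %-absorbˡ; Shape; difference-shift; difference-injective)
  open import Algebra.Bundles using (Semiring)
  open import Data.Nat.Base as ℕ using (zero; suc; _≤_; _<_; _%_; _/_)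
  import Data.Nat.Properties as ℕ
  open import Data.Nat.Divisibility using (_∣_; divides; divides-refl; n∣m*n; ∣m⇒∣m*n; *-pres-∣)
  open import Data.Nat.DivMod using (_mod_; m≡m%n+[m/n]*n; [m+kn]%n≡m%n; [m+n]%n≡m%n; m%n<n; m∣n⇒o%n%m≡o%m; +-distrib-/-∣ʳ; m*n/n≡m)
  open import Data.Nat.Tactic.RingSolver using (solve-∀)
  open import Data.Fin.Base using (Fin; toℕ)
  open import Data.Fin.Properties using (toℕ-fromℕ<; toℕ<n; toℕ-injective)
  open import Data.Product using (_,_; proj₁; proj₂; ∃)
  open import Data.Sum using (_⊎_; inj₁; inj₂)
  import Data.Sum as Sum
  open import Relation.Nullary using (¬_; contradiction)
  open import Relation.Binary.Definitions using (tri<; tri≈; tri>)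
  import Relation.Binary.PropositionalEquality as ≡
  open CommutativeRing R
  open import Algebra.Definitions.RawSemiring (Semiring.rawSemiring semiring) using (_^_; sum) renaming (_×_ to _·_)
  open import Algebra.Properties.Semiring.Exp semiring using (^-congˡ; ^-congʳ; ^-homo-*; ^-assocʳ)
  open import Algebra.Properties.Semiring.Sum semiring using (sum-cong-≋; *-distribˡ-sum; sum-replicate)
  open import Algebra.Properties.Ring ring using ([y-z]x≈yx-zx; x∙y⁻¹≈ε⇒x≈y; x≈y⇒x∙y⁻¹≈ε; +-cancelˡ)
  open import Algebra.Properties.CommutativeSemigroup *-commutativeSemigroup using (interchange; x∙yz≈yx∙z; xy∙z≈y∙xz; xy∙z≈xz∙y)
  open import Relation.Binary.Reasoning.Setoid setoid

  cancel-or-zero : ∀ a b u → a * u ≈ b * u → a ≈ b ⊎ u ≈ 0#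
  cancel-or-zero a b u au≈bu with proj₂ dom (a - b) u (trans ([y-z]x≈yx-zx u a b) (x≈y⇒x∙y⁻¹≈ε au≈bu))
  ... | inj₁ a-b≈0 = inj₁ (x∙y⁻¹≈ε⇒x≈y a b a-b≈0)
  ... | inj₂ u≈0   = inj₂ u≈0

  *-cancelʳ : ∀ {a b u} → ¬ u ≈ 0# → a * u ≈ b * u → a ≈ b
  *-cancelʳ {a} {b} {u} u≉0 au≈bu with cancel-or-zero a b u au≈bu
  ... | inj₁ a≈b = a≈b
  ... | inj₂ u≈0 = contradiction u≈0 u≉0

  *-nonzero : ∀ {x y} → ¬ x ≈ 0# → ¬ y ≈ 0# → ¬ x * y ≈ 0#
  *-nonzero x≉0 y≉0 xy≈0 with proj₂ dom _ _ xy≈0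
  ... | inj₁ x≈0 = x≉0 x≈0
  ... | inj₂ y≈0 = y≉0 y≈0

  ^-nonzero : ∀ {x} → ¬ x ≈ 0# → ∀ n → ¬ x ^ n ≈ 0#
  ^-nonzero x≉0 zero    = proj₁ dom
  ^-nonzero x≉0 (suc n) = *-nonzero x≉0 (^-nonzero x≉0 n)

  root-nonzero : ∀ {x} n → .{{_ : NonZero n}} → x ^ n ≈ 1# → ¬ x ≈ 0#
  root-nonzero {x} (suc n) xⁿ≈1 x≈0 = proj₁ dom (begin
    1#         ≈⟨ sym xⁿ≈1 ⟩
    x * x ^ n  ≈⟨ *-congʳ x≈0 ⟩
    0# * x ^ n ≈⟨ zeroˡ _ ⟩
    0#         ∎)

  inverse-unique : ∀ {a b y} → ¬ y ≈ 0# → a * y ≈ 1# → b * y ≈ 1# → a ≈ b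
  inverse-unique y≉0 ay≈1 by≈1 = *-cancelʳ y≉0 (trans ay≈1 (sym by≈1))

  1^n≈1 : ∀ n → 1# ^ n ≈ 1#
  1^n≈1 zero    = refl
  1^n≈1 (suc n) = trans (*-identityˡ _) (1^n≈1 n)

  root-power : ∀ {x n e} → x ^ n ≈ 1# → n ∣ e → x ^ e ≈ 1#
  root-power {x} {n} xⁿ≈1 (divides-refl q) = begin
    x ^ (q ℕ.* n)  ≈⟨ ^-congʳ x (ℕ.*-comm q n) ⟩
    x ^ (n ℕ.* q)  ≈⟨ sym (^-assocʳ x n q) ⟩
    (x ^ n) ^ q    ≈⟨ ^-congˡ q xⁿ≈1 ⟩
    1# ^ q         ≈⟨ 1^n≈1 q ⟩
    1#             ∎

  root-mod : ∀ {x} n → .{{_ : NonZero n}} → x ^ n ≈ 1# → ∀ e → x ^ (e % n) ≈ x ^ e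
  root-mod {x} n xⁿ≈1 e = sym (begin
    x ^ e                              ≈⟨ ^-congʳ x (m≡m%n+[m/n]*n e n) ⟩
    x ^ (e % n ℕ.+ e / n ℕ.* n)        ≈⟨ ^-homo-* x (e % n) (e / n ℕ.* n) ⟩
    x ^ (e % n) * x ^ (e / n ℕ.* n)    ≈⟨ *-congˡ (root-power xⁿ≈1 (divides-refl (e / n))) ⟩
    x ^ (e % n) * 1#                   ≈⟨ *-identityʳ _ ⟩
    x ^ (e % n)                        ∎)

  Primitive : Carrier → ℕ → Set ℓ
  Primitive x n = ∀ t → 1 ≤ t → t < n → ¬ x ^ t ≈ 1#

  primitive-distinct : ∀ {x n} → ¬ x ≈ 0# → Primitive x n →
                       ∀ {r r′} → r < r′ → r′ < n → ¬ x ^ r ≈ x ^ r′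
  primitive-distinct {x} x≉0 x-prim {r} {r′} r<r′ r′<n xʳ≈xʳ′ =
    x-prim (r′ ℕ.∸ r) (ℕ.m<n⇒0<n∸m r<r′) (ℕ.≤-<-trans (ℕ.m∸n≤m r′ r) r′<n)
      (*-cancelʳ (^-nonzero x≉0 r) (begin
        x ^ (r′ ℕ.∸ r) * x ^ r   ≈⟨ *-comm _ _ ⟩
        x ^ r * x ^ (r′ ℕ.∸ r)   ≈⟨ sym (^-homo-* x r (r′ ℕ.∸ r)) ⟩
        x ^ (r ℕ.+ (r′ ℕ.∸ r))   ≈⟨ ^-congʳ x (ℕ.m+[n∸m]≡n (ℕ.<⇒≤ r<r′)) ⟩
        x ^ r′                   ≈⟨ sym xʳ≈xʳ′ ⟩
        x ^ r                    ≈⟨ sym (*-identityˡ _) ⟩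
        1# * x ^ r               ∎))

  primitive-injective : ∀ {x n} → ¬ x ≈ 0# → Primitive x n →
                        ∀ {r r′} → r < n → r′ < n → x ^ r ≈ x ^ r′ → r ≡.≡ r′
  primitive-injective {x} {n} x≉0 x-prim {r} {r′} r<n r′<n xʳ≈xʳ′ with ℕ.<-cmp r r′
  ... | tri< r<r′ _ _ = contradiction xʳ≈xʳ′ (primitive-distinct x≉0 x-prim r<r′ r′<n)
  ... | tri≈ _ r≡r′ _ = r≡r′
  ... | tri> _ _ r′<r = contradiction (sym xʳ≈xʳ′) (primitive-distinct x≉0 x-prim r′<r r<n)

  sumTo : ℕ → (ℕ → Carrier) → Carrier
  sumTo n G = sum {n} (λ j → G (toℕ j))

  sumTo-cong : ∀ n {G H : ℕ → Carrier} → (∀ j → G j ≈ H j) → sumTo n G ≈ sumTo n H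
  sumTo-cong n G≈H = sum-cong-≋ {n} (λ j → G≈H (toℕ j))

  sumTo-last : ∀ n G → sumTo (suc n) G ≈ sumTo n G + G n
  sumTo-last zero    G = +-comm (G 0) 0#
  sumTo-last (suc n) G = begin
    G 0 + sumTo (suc n) (λ j → G (suc j))        ≈⟨ +-congˡ (sumTo-last n (λ j → G (suc j))) ⟩
    G 0 + (sumTo n (λ j → G (suc j)) + G (suc n)) ≈⟨ sym (+-assoc _ _ _) ⟩
    G 0 + sumTo n (λ j → G (suc j)) + G (suc n)   ∎

  sumTo-shift₁ : ∀ n G → G n ≈ G 0 → sumTo n (λ j → G (suc j)) ≈ sumTo n G
  sumTo-shift₁ n G Gn≈G0 = +-cancelˡ (G 0) _ _ (begin
    G 0 + sumTo n (λ j → G (suc j)) ≈⟨ sumTo-last n G ⟩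
    sumTo n G + G n                 ≈⟨ +-congˡ Gn≈G0 ⟩
    sumTo n G + G 0                 ≈⟨ +-comm _ _ ⟩
    G 0 + sumTo n G                 ∎)

  sumTo-shift : ∀ n G → (∀ j → G (j ℕ.+ n) ≈ G j) → ∀ s → sumTo n (λ j → G (j ℕ.+ s)) ≈ sumTo n G
  sumTo-shift n G periodic zero = sumTo-cong n (λ j → reflexive (≡.cong G (ℕ.+-identityʳ j)))
  sumTo-shift n G periodic (suc s) = begin
    sumTo n (λ j → G (j ℕ.+ suc s))  ≈⟨ sumTo-cong n (λ j → reflexive (≡.cong G (ℕ.+-suc j s))) ⟩
    sumTo n (λ j → G (suc j ℕ.+ s))  ≈⟨ sumTo-shift₁ n (λ j → G (j ℕ.+ s)) Gn+s≈Gs ⟩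
    sumTo n (λ j → G (j ℕ.+ s))      ≈⟨ sumTo-shift n G periodic s ⟩
    sumTo n G                        ∎
    where
    Gn+s≈Gs : G (n ℕ.+ s) ≈ G (0 ℕ.+ s)
    Gn+s≈Gs = trans (reflexive (≡.cong G (ℕ.+-comm n s))) (periodic s)

  -- The key averaging argument: if a·G(j+s) = b·G(j) for an n-periodic G,
  -- then a·∑G = b·∑G, so in a domain a = b or ∑G = 0.
  twisted-sum : ∀ n G a b s → (∀ j → G (j ℕ.+ n) ≈ G j) → (∀ j → a * G (j ℕ.+ s) ≈ b * G j) →
                a ≈ b ⊎ sumTo n G ≈ 0#
  twisted-sum n G a b s periodic twist = cancel-or-zero a b (sumTo n G) (begin
    a * sumTo n G                       ≈⟨ *-congˡ (sym (sumTo-shift n G periodic s)) ⟩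
    a * sumTo n (λ j → G (j ℕ.+ s))     ≈⟨ *-distribˡ-sum {n} a _ ⟩
    sumTo n (λ j → a * G (j ℕ.+ s))     ≈⟨ sumTo-cong n twist ⟩
    sumTo n (λ j → b * G j)             ≈⟨ sym (*-distribˡ-sum {n} b _) ⟩
    b * sumTo n G                       ∎)

  module GaussSequence (k m : ℕ) {{_ : NonZero k}} {{_ : NonZero m}} (k∣m : k ∣ m)
                       (ω ρ : Carrier) (ωᵐ≈1 : ω ^ m ≈ 1#) (ω-primitive : Primitive ω m)
                       (ρ²≈ωᵏ : ρ ^ 2 ≈ ω ^ k) (ρᵐᵐ≈1 : ρ ^ (m ℕ.* m) ≈ 1#) where

    v : ℕ
    v = k ℕ.* m

    instance
      v≢0 : NonZero v
      v≢0 = ℕ.m*n≢0 k m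

    ωρ : ℕ → ℕ → Carrier
    ωρ i j = ω ^ i * ρ ^ j

    ωρ-cong : ∀ {i i′ j j′} → i ≡.≡ i′ → j ≡.≡ j′ → ωρ i j ≈ ωρ i′ j′
    ωρ-cong i≡i′ j≡j′ = reflexive (≡.cong₂ ωρ i≡i′ j≡j′)

    ωρ-* : ∀ i j i′ j′ → ωρ i j * ωρ i′ j′ ≈ ωρ (i ℕ.+ i′) (j ℕ.+ j′)
    ωρ-* i j i′ j′ = begin
      (ω ^ i * ρ ^ j) * (ω ^ i′ * ρ ^ j′)  ≈⟨ interchange _ _ _ _ ⟩
      (ω ^ i * ω ^ i′) * (ρ ^ j * ρ ^ j′)  ≈⟨ *-cong (sym (^-homo-* ω i i′)) (sym (^-homo-* ρ j j′)) ⟩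
      ωρ (i ℕ.+ i′) (j ℕ.+ j′)             ∎

    ωρ-square : ∀ i n j → ωρ i (2 ℕ.* n ℕ.+ j) ≈ ωρ (k ℕ.* n ℕ.+ i) j
    ωρ-square i n j = begin
      ω ^ i * ρ ^ (2 ℕ.* n ℕ.+ j)        ≈⟨ *-congˡ (^-homo-* ρ (2 ℕ.* n) j) ⟩
      ω ^ i * (ρ ^ (2 ℕ.* n) * ρ ^ j)    ≈⟨ *-congˡ (*-congʳ ρ²ⁿ≈ωᵏⁿ) ⟩
      ω ^ i * (ω ^ (k ℕ.* n) * ρ ^ j)    ≈⟨ x∙yz≈yx∙z _ _ _ ⟩
      (ω ^ (k ℕ.* n) * ω ^ i) * ρ ^ j    ≈⟨ *-congʳ (sym (^-homo-* ω (k ℕ.* n) i)) ⟩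
      ωρ (k ℕ.* n ℕ.+ i) j               ∎
      where
      ρ²ⁿ≈ωᵏⁿ : ρ ^ (2 ℕ.* n) ≈ ω ^ (k ℕ.* n)
      ρ²ⁿ≈ωᵏⁿ = trans (sym (^-assocʳ ρ 2 n)) (trans (^-congˡ n ρ²≈ωᵏ) (^-assocʳ ω k n))

    ωρ-trivial : ∀ {i j} → m ∣ i → m ℕ.* m ∣ j → ωρ i j ≈ 1#
    ωρ-trivial m∣i mm∣j = trans (*-cong (root-power ωᵐ≈1 m∣i) (root-power ρᵐᵐ≈1 mm∣j)) (*-identityˡ 1#)

    ωρ-nonzero : ∀ i j → ¬ ωρ i j ≈ 0#
    ωρ-nonzero i j = *-nonzero (^-nonzero (root-nonzero m ωᵐ≈1) i)
                               (^-nonzero (root-nonzero (m ℕ.* m) {{ℕ.m*n≢0 m m}} ρᵐᵐ≈1) j)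

    gauss : ℕ → Carrier
    gauss x = ωρ (x % k ℕ.* (x / k)) (x / k ℕ.* (x / k))

    gauss-nonzero : ∀ x → ¬ gauss x ≈ 0#
    gauss-nonzero x = ωρ-nonzero (x % k ℕ.* (x / k)) (x / k ℕ.* (x / k))

    gauss-step : ∀ x t → gauss (x ℕ.+ t ℕ.* k) ≈ gauss x * ωρ (t ℕ.* x) (t ℕ.* t)
    gauss-step x t = begin
      gauss (x ℕ.+ t ℕ.* k)                          ≈⟨ ωρ-cong (≡.cong₂ ℕ._*_ rem quo) (≡.cong₂ ℕ._*_ quo quo) ⟩
      ωρ (a ℕ.* (b ℕ.+ t)) ((b ℕ.+ t) ℕ.* (b ℕ.+ t)) ≈⟨ ωρ-cong {a ℕ.* (b ℕ.+ t)} ≡.refl (square b t) ⟩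
      ωρ (a ℕ.* (b ℕ.+ t)) (2 ℕ.* (b ℕ.* t) ℕ.+ (b ℕ.* b ℕ.+ t ℕ.* t)) ≈⟨ ωρ-square (a ℕ.* (b ℕ.+ t)) (b ℕ.* t) (b ℕ.* b ℕ.+ t ℕ.* t) ⟩
      ωρ (k ℕ.* (b ℕ.* t) ℕ.+ a ℕ.* (b ℕ.+ t)) (b ℕ.* b ℕ.+ t ℕ.* t)   ≈⟨ ωρ-cong {j = b ℕ.* b ℕ.+ t ℕ.* t} ω-exponent ≡.refl ⟩
      ωρ (a ℕ.* b ℕ.+ t ℕ.* x) (b ℕ.* b ℕ.+ t ℕ.* t) ≈⟨ sym (ωρ-* (a ℕ.* b) (b ℕ.* b) (t ℕ.* x) (t ℕ.* t)) ⟩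
      gauss x * ωρ (t ℕ.* x) (t ℕ.* t)               ∎
      where
      a = x % k
      b = x / k
      rem : (x ℕ.+ t ℕ.* k) % k ≡.≡ a
      rem = [m+kn]%n≡m%n x t k
      quo : (x ℕ.+ t ℕ.* k) / k ≡.≡ b ℕ.+ t
      quo = ≡.trans (+-distrib-/-∣ʳ x (divides t ≡.refl)) (≡.cong (b ℕ.+_) (m*n/n≡m t k))
      square : ∀ b t → (b ℕ.+ t) ℕ.* (b ℕ.+ t) ≡.≡ 2 ℕ.* (b ℕ.* t) ℕ.+ (b ℕ.* b ℕ.+ t ℕ.* t)
      square = solve-∀
      expand : ∀ a b t k → k ℕ.* (b ℕ.* t) ℕ.+ a ℕ.* (b ℕ.+ t) ≡.≡ a ℕ.* b ℕ.+ t ℕ.* (a ℕ.+ b ℕ.* k)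
      expand = solve-∀
      ω-exponent : k ℕ.* (b ℕ.* t) ℕ.+ a ℕ.* (b ℕ.+ t) ≡.≡ a ℕ.* b ℕ.+ t ℕ.* x
      ω-exponent = ≡.trans (expand a b t k) (≡.cong (λ y → a ℕ.* b ℕ.+ t ℕ.* y) (≡.sym (m≡m%n+[m/n]*n x k)))

    -- g is periodic modulo v: x and x % v differ by (x/v)·m whole blocks.
    gauss-mod : ∀ x → gauss (x % v) ≈ gauss x
    gauss-mod x = sym (begin
      gauss x                                ≈⟨ reflexive (≡.cong gauss x≡r+tk) ⟩
      gauss (x % v ℕ.+ t ℕ.* k)              ≈⟨ gauss-step (x % v) t ⟩
      gauss (x % v) * ωρ (t ℕ.* (x % v)) (t ℕ.* t)
        ≈⟨ *-congˡ (ωρ-trivial (∣m⇒∣m*n (x % v) (n∣m*n (x / v))) (*-pres-∣ (n∣m*n (x / v)) (n∣m*n (x / v)))) ⟩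
      gauss (x % v) * 1#                     ≈⟨ *-identityʳ _ ⟩
      gauss (x % v)                          ∎)
      where
      t = x / v ℕ.* m
      regroup : ∀ q k m → q ℕ.* (k ℕ.* m) ≡.≡ q ℕ.* m ℕ.* k
      regroup = solve-∀
      x≡r+tk : x ≡.≡ x % v ℕ.+ t ℕ.* k
      x≡r+tk = ≡.trans (m≡m%n+[m/n]*n x v) (≡.cong (x % v ℕ.+_) (regroup (x / v) k m))

    gauss-cong-mod : ∀ {x y} → x % v ≡.≡ y % v → gauss x ≈ gauss y
    gauss-cong-mod {x} {y} x≡y = trans (sym (gauss-mod x)) (trans (reflexive (≡.cong gauss x≡y)) (gauss-mod y))

    ωρ-split : ∀ c i j → ωρ (c ℕ.+ i) j ≈ ω ^ c * ωρ i j
    ωρ-split c i j = trans (*-congʳ (^-homo-* ω c i)) (*-assoc _ _ _)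

    -- Correlations of g with its shifts, for any family conj of inverses of
    -- the values of g (over ℂ: the complex conjugates).
    module Correlation (conj : ℕ → Carrier) (conj-inverse : ∀ y → conj y * gauss y ≈ 1#) where

      -- conj is v-periodic as well, being determined by g.
      conj-cong-mod : ∀ {x y} → x % v ≡.≡ y % v → conj x ≈ conj y
      conj-cong-mod {x} {y} x≡y = inverse-unique (gauss-nonzero y)
        (trans (*-congˡ (sym (gauss-cong-mod x≡y))) (conj-inverse x)) (conj-inverse y)

      conj-step : ∀ x s u → gauss (x ℕ.+ s) ≈ gauss x * u → conj (x ℕ.+ s) * u ≈ conj x
      conj-step x s u step = inverse-unique (gauss-nonzero x) (begin
        conj (x ℕ.+ s) * u * gauss x    ≈⟨ *-assoc _ _ _ ⟩
        conj (x ℕ.+ s) * (u * gauss x)  ≈⟨ *-congˡ (trans (*-comm _ _) (sym step)) ⟩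
        conj (x ℕ.+ s) * gauss (x ℕ.+ s) ≈⟨ conj-inverse _ ⟩
        1#                              ∎) (conj-inverse x)

      term : ℕ → ℕ → ℕ → Carrier
      term c c′ j = gauss (j ℕ.+ c) * conj (j ℕ.+ c′)

      correlation : ℕ → ℕ → Carrier
      correlation c c′ = sumTo v (term c c′)

      term-periodic : ∀ c c′ j → term c c′ (j ℕ.+ v) ≈ term c c′ j
      term-periodic c c′ j = *-cong (gauss-cong-mod (drop-v c)) (conj-cong-mod (drop-v c′))
        where
        drop-v : ∀ c → (j ℕ.+ v ℕ.+ c) % v ≡.≡ (j ℕ.+ c) % v
        drop-v c = ≡.trans (≡.cong (_% v) (swap j v c)) ([m+n]%n≡m%n (j ℕ.+ c) v)
          where
          swap : ∀ j v c → j ℕ.+ v ℕ.+ c ≡.≡ j ℕ.+ c ℕ.+ v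
          swap = solve-∀

      term-step : ∀ s (u : ℕ → Carrier) → (∀ x → gauss (x ℕ.+ s) ≈ gauss x * u x) →
                  ∀ c c′ j → term c c′ (j ℕ.+ s) * u (j ℕ.+ c′) ≈ term c c′ j * u (j ℕ.+ c)
      term-step s u step c c′ j = begin
        gauss (j ℕ.+ s ℕ.+ c) * conj (j ℕ.+ s ℕ.+ c′) * u (j ℕ.+ c′)
          ≈⟨ *-congʳ (*-cong (reflexive (≡.cong gauss (swap j s c))) (reflexive (≡.cong conj (swap j s c′)))) ⟩
        gauss (j ℕ.+ c ℕ.+ s) * conj (j ℕ.+ c′ ℕ.+ s) * u (j ℕ.+ c′)  ≈⟨ *-assoc _ _ _ ⟩
        gauss (j ℕ.+ c ℕ.+ s) * (conj (j ℕ.+ c′ ℕ.+ s) * u (j ℕ.+ c′))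
          ≈⟨ *-cong (step (j ℕ.+ c)) (conj-step (j ℕ.+ c′) s (u (j ℕ.+ c′)) (step (j ℕ.+ c′))) ⟩
        gauss (j ℕ.+ c) * u (j ℕ.+ c) * conj (j ℕ.+ c′)               ≈⟨ xy∙z≈xz∙y _ _ _ ⟩
        term c c′ j * u (j ℕ.+ c)                                     ∎
        where
        swap : ∀ j s c → j ℕ.+ s ℕ.+ c ≡.≡ j ℕ.+ c ℕ.+ s
        swap = solve-∀

      -- Shifting by one block k: ω^c′ · term(j + k) = ω^c · term(j).  Hence
      -- either the correlation vanishes or c ≡ c′ (mod m).
      block-twist : ∀ c c′ j → ω ^ c′ * term c c′ (j ℕ.+ 1 ℕ.* k) ≈ ω ^ c * term c c′ j
      block-twist c c′ j = *-cancelʳ (ωρ-nonzero (1 ℕ.* j) 1) (begin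
        ω ^ c′ * term c c′ (j ℕ.+ 1 ℕ.* k) * W    ≈⟨ xy∙z≈y∙xz _ _ _ ⟩
        term c c′ (j ℕ.+ 1 ℕ.* k) * (ω ^ c′ * W)  ≈⟨ *-congˡ (sym (u-split c′)) ⟩
        term c c′ (j ℕ.+ 1 ℕ.* k) * u (j ℕ.+ c′)  ≈⟨ term-step (1 ℕ.* k) u (λ x → gauss-step x 1) c c′ j ⟩
        term c c′ j * u (j ℕ.+ c)                 ≈⟨ *-congˡ (u-split c) ⟩
        term c c′ j * (ω ^ c * W)                 ≈⟨ sym (xy∙z≈y∙xz _ _ _) ⟩
        ω ^ c * term c c′ j * W                   ∎)
        where
        u : ℕ → Carrier
        u x = ωρ (1 ℕ.* x) 1
        W = u j
        u-split : ∀ c → u (j ℕ.+ c) ≈ ω ^ c * W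
        u-split c = trans (ωρ-cong {j = 1} (reorder j c) ≡.refl) (ωρ-split c (1 ℕ.* j) 1)
          where
          reorder : ∀ j c → 1 ℕ.* (j ℕ.+ c) ≡.≡ c ℕ.+ 1 ℕ.* j
          reorder = solve-∀

      powers-agree : ∀ c c′ → ω ^ c′ ≈ ω ^ c → c % m ≡.≡ c′ % m
      powers-agree c c′ ωᶜ′≈ωᶜ = primitive-injective (root-nonzero m ωᵐ≈1) ω-primitive (m%n<n c m) (m%n<n c′ m)
        (trans (root-mod m ωᵐ≈1 c) (trans (sym ωᶜ′≈ωᶜ) (sym (root-mod m ωᵐ≈1 c′))))

      -- By the averaging argument applied to the block shift.
      residues-agree : ∀ c c′ → c % m ≡.≡ c′ % m ⊎ correlation c c′ ≈ 0#
      residues-agree c c′ = Sum.map₁ (powers-agree c c′)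
        (twisted-sum v (term c c′) (ω ^ c′) (ω ^ c) (1 ℕ.* k) (term-periodic c c′) (block-twist c c′))

      -- If c′ ≡ c + t·k (mod v) with 0 < t < m, then term(j)·U(j + c) = 1 for
      -- U(x) = ω^(t·x) ρ^(t²), and U(x + 1) = ω^t·U(x); so ω^t · term(j+1) =
      -- term(j), and the correlation vanishes because ω^t ≠ 1.
      shifted-vanishes : ∀ c c′ t → 1 ≤ t → t ℕ.< m → (c ℕ.+ t ℕ.* k) % v ≡.≡ c′ % v → correlation c c′ ≈ 0#
      shifted-vanishes c c′ t 1≤t t<m c+tk≡c′ =
        Sum.fromInj₂ (λ ωᵗ≈1 → contradiction ωᵗ≈1 (ω-primitive t 1≤t t<m))
          (twisted-sum v (term c c′) (ω ^ t) 1# 1 (term-periodic c c′) unit-twist)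
        where
        U : ℕ → Carrier
        U x = ωρ (t ℕ.* x) (t ℕ.* t)
        U-suc : ∀ x → U (suc x) ≈ ω ^ t * U x
        U-suc x = trans (ωρ-cong {j = t ℕ.* t} (ℕ.*-suc t x) ≡.refl) (ωρ-split t (t ℕ.* x) (t ℕ.* t))
        gauss-shifted : ∀ j → gauss (j ℕ.+ c′) ≈ gauss (j ℕ.+ c) * U (j ℕ.+ c)
        gauss-shifted j = trans (gauss-cong-mod same-residue) (gauss-step (j ℕ.+ c) t)
          where
          same-residue : (j ℕ.+ c′) % v ≡.≡ (j ℕ.+ c ℕ.+ t ℕ.* k) % v
          same-residue = ≡.trans (+-cong-mod v j (≡.sym c+tk≡c′)) (≡.cong (_% v) (≡.sym (ℕ.+-assoc j c (t ℕ.* k))))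
        term-U : ∀ j → term c c′ j * U (j ℕ.+ c) ≈ 1#
        term-U j = begin
          gauss (j ℕ.+ c) * conj (j ℕ.+ c′) * U (j ℕ.+ c)  ≈⟨ xy∙z≈y∙xz _ _ _ ⟩
          conj (j ℕ.+ c′) * (gauss (j ℕ.+ c) * U (j ℕ.+ c)) ≈⟨ *-congˡ (sym (gauss-shifted j)) ⟩
          conj (j ℕ.+ c′) * gauss (j ℕ.+ c′)               ≈⟨ conj-inverse _ ⟩
          1#                                               ∎
        unit-twist : ∀ j → ω ^ t * term c c′ (j ℕ.+ 1) ≈ 1# * term c c′ j
        unit-twist j = *-cancelʳ (ωρ-nonzero (t ℕ.* (j ℕ.+ c)) (t ℕ.* t)) (begin
          ω ^ t * term c c′ (j ℕ.+ 1) * U (j ℕ.+ c)   ≈⟨ xy∙z≈y∙xz _ _ _ ⟩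
          term c c′ (j ℕ.+ 1) * (ω ^ t * U (j ℕ.+ c)) ≈⟨ *-congˡ (sym (trans (reflexive (≡.cong U (next j))) (U-suc (j ℕ.+ c)))) ⟩
          term c c′ (j ℕ.+ 1) * U (j ℕ.+ 1 ℕ.+ c)     ≈⟨ term-U (j ℕ.+ 1) ⟩
          1#                                          ≈⟨ sym (term-U j) ⟩
          term c c′ j * U (j ℕ.+ c)                   ≈⟨ *-congʳ (sym (*-identityˡ _)) ⟩
          1# * term c c′ j * U (j ℕ.+ c)              ∎)
          where
          next : ∀ j → j ℕ.+ 1 ℕ.+ c ≡.≡ suc (j ℕ.+ c)
          next j = ≡.cong (ℕ._+ c) (ℕ.+-comm j 1)

      orthogonal : ∀ c c′ → ¬ c % v ≡.≡ c′ % v → correlation c c′ ≈ 0#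
      orthogonal c c′ c≢c′ = Sum.fromInj₂ via-gap (residues-agree c c′)
        where
        reduce : ∀ c → c % v % m ≡.≡ c % m
        reduce c = m∣n⇒o%n%m≡o%m m v c (divides k ≡.refl)
        via-gap : c % m ≡.≡ c′ % m → correlation c c′ ≈ 0#
        via-gap c≡c′[m] =
          let t , (1≤t , t<m) , c%v+tk≡c′%v = residue-gap k m k∣m (m%n<n c v) (m%n<n c′ v) c≢c′
                                                (≡.trans (reduce c) (≡.trans c≡c′[m] (≡.sym (reduce c′))))
          in shifted-vanishes c c′ t 1≤t t<m
               (≡.trans (≡.sym (%-absorbˡ v c (t ℕ.* k))) c%v+tk≡c′%v)

  root-complement : ∀ {x h i} → x ^ h ≈ 1# → i ≤ h → x ^ (h ℕ.∸ i) * x ^ i ≈ 1#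
  root-complement {x} {h} {i} xʰ≈1 i≤h =
    trans (sym (^-homo-* x (h ℕ.∸ i) i)) (trans (^-congʳ x (ℕ.m∸n+n≡m i≤h)) xʰ≈1)

  -- The circulant matrix built from a Shape: entry (g, j) is ζ^e(j − g) where
  -- e(x) = w·a·b + B·b² for x = a + b·k, i.e. the Gauss sequence for ω = ζ^w,
  -- ρ = ζ^B.  Its rows are the shifts of that sequence, hence orthogonal.
  module Construction (h : ℕ) .{{_ : NonZero h}} (ζ : Carrier) (ζ-root : IsPrimitiveRoot R h ζ)
                      (k m w B X : ℕ) {{_ : NonZero k}} {{_ : NonZero m}} (k∣m : k ∣ m)
                      (h≡wm : h ≡.≡ w ℕ.* m) (2B≡kw+Xh : 2 ℕ.* B ≡.≡ k ℕ.* w ℕ.+ X ℕ.* h)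
                      (h∣Bm² : h ∣ B ℕ.* (m ℕ.* m)) where

    ζʰ≈1 : ζ ^ h ≈ 1#
    ζʰ≈1 = proj₁ ζ-root

    ω ρ : Carrier
    ω = ζ ^ w
    ρ = ζ ^ B

    ωᵐ≈1 : ω ^ m ≈ 1#
    ωᵐ≈1 = trans (^-assocʳ ζ w m) (trans (^-congʳ ζ (≡.sym h≡wm)) ζʰ≈1)

    -- ω^t = ζ^(w·t) with 0 < w·t < w·m = h.
    ω-primitive : Primitive ω m
    ω-primitive t 1≤t t<m ωᵗ≈1 = proj₂ ζ-root (w ℕ.* t) (ℕ.*-mono-≤ 1≤w 1≤t)
      (≡.subst (w ℕ.* t ℕ.<_) (≡.sym h≡wm) (ℕ.*-monoʳ-< w {{ℕ.>-nonZero 1≤w}} t<m))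
      (trans (sym (^-assocʳ ζ w t)) ωᵗ≈1)
      where
      1≤w : 1 ≤ w
      1≤w = ℕ.>-nonZero⁻¹ w {{ℕ.m*n≢0⇒m≢0 w {{≡.subst NonZero h≡wm (ℕ.≢-nonZero (ℕ.≢-nonZero⁻¹ h))}}}}

    ρ²≈ωᵏ : ρ ^ 2 ≈ ω ^ k
    ρ²≈ωᵏ = begin
      ρ ^ 2                              ≈⟨ ^-assocʳ ζ B 2 ⟩
      ζ ^ (B ℕ.* 2)                      ≈⟨ ^-congʳ ζ (≡.trans (ℕ.*-comm B 2) 2B≡kw+Xh) ⟩
      ζ ^ (k ℕ.* w ℕ.+ X ℕ.* h)          ≈⟨ ^-homo-* ζ (k ℕ.* w) (X ℕ.* h) ⟩
      ζ ^ (k ℕ.* w) * ζ ^ (X ℕ.* h)      ≈⟨ *-congˡ (root-power ζʰ≈1 (divides X ≡.refl)) ⟩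
      ζ ^ (k ℕ.* w) * 1#                 ≈⟨ *-identityʳ _ ⟩
      ζ ^ (k ℕ.* w)                      ≈⟨ ^-congʳ ζ (ℕ.*-comm k w) ⟩
      ζ ^ (w ℕ.* k)                      ≈⟨ sym (^-assocʳ ζ w k) ⟩
      ω ^ k                              ∎

    ρᵐᵐ≈1 : ρ ^ (m ℕ.* m) ≈ 1#
    ρᵐᵐ≈1 = trans (^-assocʳ ζ B (m ℕ.* m)) (root-power ζʰ≈1 h∣Bm²)

    open GaussSequence k m k∣m ω ρ ωᵐ≈1 ω-primitive ρ²≈ωᵏ ρᵐᵐ≈1 public

    exponent : ℕ → ℕ
    exponent x = w ℕ.* (x % k ℕ.* (x / k)) ℕ.+ B ℕ.* (x / k ℕ.* (x / k))

    ζ^exponent : ∀ x → ζ ^ exponent x ≈ gauss x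
    ζ^exponent x = trans (^-homo-* ζ (w ℕ.* ab) (B ℕ.* bb)) (*-cong (sym (^-assocʳ ζ w ab)) (sym (^-assocʳ ζ B bb)))
      where
      ab = x % k ℕ.* (x / k)
      bb = x / k ℕ.* (x / k)

    code : ℕ → Fin h
    code x = exponent (x % v) mod h

    ζ^code : ∀ x → ζ ^ toℕ (code x) ≈ gauss x
    ζ^code x = begin
      ζ ^ toℕ (code x)              ≈⟨ ^-congʳ ζ (toℕ-fromℕ< (m%n<n (exponent (x % v)) h)) ⟩
      ζ ^ (exponent (x % v) % h)    ≈⟨ root-mod h ζʰ≈1 (exponent (x % v)) ⟩
      ζ ^ exponent (x % v)          ≈⟨ ζ^exponent (x % v) ⟩
      gauss (x % v)                 ≈⟨ gauss-mod x ⟩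
      gauss x                       ∎

    conj : ℕ → Carrier
    conj x = ζ ^ (h ℕ.∸ toℕ (code x))

    conj-inverse : ∀ x → conj x * gauss x ≈ 1#
    conj-inverse x = trans (*-congˡ (sym (ζ^code x))) (root-complement ζʰ≈1 (ℕ.<⇒≤ (toℕ<n (code x))))

    open Correlation conj conj-inverse

    difference : Fin v → Fin v → ℕ
    difference g j = toℕ j ℕ.+ ℕ.pred v ℕ.* toℕ g

    -- The exponent matrix; it is circulant, since only j − g matters.
    matrix : Fin v → Fin v → Fin h
    matrix g j = code (difference g j)

    matrix-invariant : IsInvariant R v h ζ matrix
    matrix-invariant g j l = ≡.cong (λ y → exponent y mod h) (≡.trans
      (≡.cong₂ (λ a b → (a ℕ.+ ℕ.pred v ℕ.* b) % v) (toℕ-fromℕ< (m%n<n (toℕ j ℕ.+ toℕ l) v))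
                                                        (toℕ-fromℕ< (m%n<n (toℕ g ℕ.+ toℕ l) v)))
      (difference-shift v (toℕ j) (toℕ g) (toℕ l)))

    -- Row g times row g′ is the correlation of the shifts by (v−1)·g and
    -- (v−1)·g′, which differ modulo v unless g = g′.
    matrix-orthogonal : IsOrthogonal R v h ζ matrix
    matrix-orthogonal g g′ = diagonal , off-diagonal
      where
      row-product : Fin v → Fin v → Fin v → Carrier
      row-product g g′ j = entry R v h ζ matrix g j * conjEntry R v h ζ matrix g′ j
      diagonal : g ≡.≡ g′ → sum (row-product g g′) ≈ v · 1#
      diagonal ≡.refl = trans (sum-cong-≋ {v} (λ j → trans (*-comm _ _) (root-complement ζʰ≈1 (ℕ.<⇒≤ (toℕ<n (matrix g j))))))
                              (sum-replicate v)
      off-diagonal : ¬ g ≡.≡ g′ → sum (row-product g g′) ≈ 0#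
      off-diagonal g≢g′ = trans (sum-cong-≋ {v} (λ j → *-congʳ (ζ^code (difference g j))))
        (orthogonal _ _ (λ same → g≢g′ (toℕ-injective (difference-injective v (toℕ<n g) (toℕ<n g′) same))))

  bh-from-shape : ∀ {v h} .{{_ : NonZero v}} .{{_ : NonZero h}} → Shape v h → (ζ : Carrier) →
                  IsPrimitiveRoot R h ζ → ∃ λ (E : Fin v → Fin v → Fin h) → IsBH R v h ζ E
  bh-from-shape {h = h} record { k = k ; m = m ; w = w ; B = B ; X = X ; k≢0 = k≢0 ; m≢0 = m≢0
                               ; v≡km = ≡.refl ; h≡wm = h≡wm ; k∣m = k∣m ; 2B≡kw+Xh = 2B≡kw+Xh ; h∣Bm² = h∣Bm² }
                ζ ζ-root = matrix , matrix-invariant , matrix-orthogonal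
    where open Construction h ζ ζ-root k m w B X {{k≢0}} {{m≢0}} k∣m h≡wm 2B≡kw+Xh h∣Bm²

open Arithmetic using (shape)
open IntegralDomainFacts using (bh-from-shape)

corollary2p5 : ∀ {c ℓ} (v h : ℕ) → .{{_ : NonZero v}} → .{{_ : NonZero h}} →
    CondI v h → CondII v h →
    (R : CommutativeRing c ℓ) → IsIntegralDomain R → CharZero R →
    (ζ : CommutativeRing.Carrier R) → IsPrimitiveRoot R h ζ →
    ∃ λ (E : Fin v → Fin v → Fin h) → IsBH R v h ζ E
corollary2p5 v h condI condII R domain _ ζ ζ-primitive =
  bh-from-shape R domain (shape v h condI condII) ζ ζ-primitive
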